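{- Let $d\ge 2$. A domain $D\subset T_d$ with $|D|\ge 2$ is isoperimetrically optimal, i.e. $|\partial D|=I_d(|D|)$, if and only if $\tau(D)\le d-2$.
   Context: $T_d$ is the $d$-regular tree. A domain is a finite nonempty connected set of vertices of $T_d$. For $x\in D$, $\deg_D(x)$ is the number of neighbors of $x$ in $D$; $\partial D=\{x\in D\mid \deg_D(x)<d\}$ is the inner boundary. $I_d(k)=\min\{|\partial D|\mid D\subset T_d\text{ a domain},\ |D|=k\}$. The boundary branching excess of a domain with $|D|\ge 2$ is $\tau(D)=\sum_{x\in\partial D}(\deg_D(x)-1)$. -}

module Defs where

open import Data.Nat using (ℕ; zero; suc; _∸_; _≤_; _<ᵇ_)
open import Data.Bool using (Bool; true; false; not; _∧_; _∨_; T)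
open import Data.Fin as Fin using (Fin)
open import Data.List using (List; []; _∷_; length; filterᵇ; map)
open import Data.Nat.ListAction using (sum)
open import Data.List.Properties using (≡-dec)
open import Data.List.Membership.Propositional using (_∈_)
open import Data.List.Relation.Unary.All using (All)
open import Data.List.Relation.Unary.Unique.Propositional using (Unique)
open import Data.Product using (Σ; _×_)
open import Relation.Nullary using (does)
open import Relation.Binary.PropositionalEquality using (_≡_)

-- The d-regular tree T_d, realised as the Cayley graph of the free product
-- of d copies of Z/2: vertices are reduced words over the alphabet Fin d
-- (no two consecutive equal letters); y is a child of x iff y = a ∷ x.

Word : ℕ → Set
Word d = List (Fin d)

reduced : ∀ {d} → Word d → Bool
reduced [] = true
reduced (a ∷ []) = true
reduced (a ∷ b ∷ w) = not (does (a Fin.≟ b)) ∧ reduced (b ∷ w)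

Reduced : ∀ {d} → Word d → Set
Reduced w = T (reduced w)

_≟w_ : ∀ {d} (x y : Word d) → _
_≟w_ = ≡-dec Fin._≟_

childOf : ∀ {d} → Word d → Word d → Bool
childOf x [] = false
childOf x (a ∷ y) = does (y ≟w x)

adjacent : ∀ {d} → Word d → Word d → Bool
adjacent x y = childOf x y ∨ childOf y x

data Walk {d} (S : List (Word d)) : Word d → Word d → Set where
  stay : ∀ {x} → x ∈ S → Walk S x x
  step : ∀ {x y z} → x ∈ S → T (adjacent x y) → Walk S y z → Walk S x z

record Domain (d : ℕ) : Set where
  field
    verts     : List (Word d)
    reducedV  : All Reduced verts
    unique    : Unique verts
    nonempty  : 1 ≤ length verts
    connected : ∀ {x y} → x ∈ verts → y ∈ verts → Walk verts x y
open Domain public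

size : ∀ {d} → Domain d → ℕ
size D = length (verts D)

deg : ∀ {d} → Domain d → Word d → ℕ
deg D x = length (filterᵇ (adjacent x) (verts D))

boundary : ∀ {d} → Domain d → List (Word d)
boundary {d} D = filterᵇ (λ x → deg D x <ᵇ d) (verts D)

bsize : ∀ {d} → Domain d → ℕ
bsize D = length (boundary D)

IsIsoperimetricProfile : (d k m : ℕ) → Set
IsIsoperimetricProfile d k m =
  Σ (Domain d) (λ E → size E ≡ k × bsize E ≡ m)
  × (∀ (E : Domain d) → size E ≡ k → m ≤ bsize E)

-- τ(D) = Σ_{x ∈ ∂D} (deg_D(x) − 1)   (for |D| ≥ 2 all degrees are ≥ 1, so ∸ is exact)
τ : ∀ {d} → Domain d → ℕ
τ D = sum (map (λ x → deg D x ∸ 1) (boundary D))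

{-# OPTIONS --safe #-}
module Submission where

-- In a domain D of T_d with |D| ≥ 2 every vertex has degree at least 1, the vertices off ∂D
-- have degree d, and the degrees sum to 2(|D| − 1) because D is a subtree. Splitting the
-- degree sum over ∂D and D ∖ ∂D gives
--   (d − 1)|∂D| = (d − 2)|D| + 2 + τ(D),
-- so at a fixed size |∂D| is monotone in τ, and lowering τ by less than d − 1 cannot lower
-- |∂D|. A caterpillar, which fills one vertex up to degree d before starting the next, has
-- τ ≤ d − 2 at every size: an optimal D therefore has τ(D) ≤ d − 2, and conversely
-- τ(D) ≤ d − 2 leaves no room for a domain of the same size with smaller boundary.

open import Defs
open import Data.Bool using (Bool; true; false; not; _∨_; T)
open import Data.Bool.Properties using (T-∨; T-not-≡)
open import Data.Empty using (⊥-elim)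
open import Data.Fin as Fin using (Fin; punchIn; punchOut)
open import Data.Fin.Properties using (punchIn-punchOut; punchInᵢ≢i; punchIn-injective)
open import Data.List using (List; []; _∷_; _++_; length; filterᵇ; map; tabulate; allFin)
open import Data.List.Properties
  using (length-tabulate; length-++-sucʳ; ∷-injectiveˡ; map-cong;
         filter-accept; filter-reject; filter-none; filter-some)
open import Data.List.Membership.Propositional using (_∈_; _∉_)
open import Data.List.Membership.Propositional.Properties
  using (∈-filter⁻; ∈-tabulate⁺; ∈-∃++; ∈-++⁻; ∈-++⁺ˡ; ∈-++⁺ʳ)
open import Data.List.Relation.Binary.Subset.Propositional using (_⊆_)
open import Data.List.Relation.Binary.Pointwise using (≡⇒Pointwise-≡; Pointwise-≡⇒≡)
open import Data.List.Relation.Binary.Suffix.Heterogeneous using (Suffix; here; there)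
import Data.List.Relation.Binary.Suffix.Heterogeneous.Properties as Suffix
open import Data.List.Relation.Unary.Any as Any using (here; there)
open import Data.List.Relation.Unary.All as All using (All; []; _∷_)
open import Data.List.Relation.Unary.All.Properties using (¬Any⇒All¬; tabulate⁺)
open import Data.List.Relation.Unary.AllPairs using ([]; _∷_)
open import Data.List.Relation.Unary.Unique.Propositional using (Unique)
open import Data.List.Relation.Unary.Unique.Propositional.Properties as Unique using (allFin⁺)
open import Data.Nat using (ℕ; zero; suc; _+_; _*_; _∸_; _≤_; _<_; _<ᵇ_; z≤n; s≤s)
open import Data.Nat.ListAction using (sum)
open import Data.Nat.Properties
open import Data.Nat.Tactic.RingSolver using (solve-∀)
open import Algebra.Properties.CommutativeSemigroup +-commutativeSemigroup
  using (interchange; x∙yz≈y∙xz)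
open import Data.Product using (∃-syntax; _×_; _,_; proj₁; proj₂)
open import Data.Sum using (_⊎_; inj₁; inj₂)
open import Data.Unit using (tt)
open import Function using (_∘_; id)
open import Function.Bundles using (_⇔_; mk⇔; Equivalence)
open import Relation.Binary.Definitions using (DecidableEquality)
open import Relation.Binary.PropositionalEquality
open import Relation.Nullary using (¬_; yes; no)
open import Relation.Nullary.Decidable using (T?)

indicator : Bool → ℕ
indicator true  = 1
indicator false = 0

count : {A : Set} → (A → Bool) → List A → ℕ
count p xs = length (filterᵇ p xs)

module _ {A : Set} where

  count-∷ : (p : A → Bool) (x : A) (xs : List A) →
            count p (x ∷ xs) ≡ indicator (p x) + count p xs
  count-∷ p x xs with p x
  ... | true  = refl
  ... | false = refl

  count≡sum : (p : A → Bool) (xs : List A) → count p xs ≡ sum (map (indicator ∘ p) xs)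
  count≡sum p []       = refl
  count≡sum p (x ∷ xs) = trans (count-∷ p x xs) (cong (indicator (p x) +_) (count≡sum p xs))

  count-∨ : (p q : A → Bool) (xs : List A) → (∀ x → T (p x) → ¬ T (q x)) →
            count (λ x → p x ∨ q x) xs ≡ count p xs + count q xs
  count-∨ p q []       disjoint = refl
  count-∨ p q (x ∷ xs) disjoint with p x in px | q x in qx
  ... | true  | true  = ⊥-elim (disjoint x (subst T (sym px) tt) (subst T (sym qx) tt))
  ... | true  | false = cong suc (count-∨ p q xs disjoint)
  ... | false | true  = trans (cong suc (count-∨ p q xs disjoint)) (sym (+-suc _ _))
  ... | false | false = count-∨ p q xs disjoint

  count+count-not≡length : (p : A → Bool) (xs : List A) →
                           count p xs + count (not ∘ p) xs ≡ length xs
  count+count-not≡length p []       = refl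
  count+count-not≡length p (x ∷ xs) with p x
  ... | true  = cong suc (count+count-not≡length p xs)
  ... | false = trans (+-suc _ _) (cong suc (count+count-not≡length p xs))

  count≡1 : {p : A → Bool} {xs : List A} {v : A} → Unique xs → v ∈ xs → T (p v) →
            (∀ {x} → x ∈ xs → T (p x) → x ≡ v) → count p xs ≡ 1
  count≡1 {p} {x ∷ xs} (x∉xs ∷ unique) (here refl) pv only-v
    rewrite filter-accept (T? ∘ p) {xs = xs} pv =
    cong suc (cong length (filter-none (T? ∘ p)
      (All.tabulate λ y∈xs py → All.lookup x∉xs y∈xs (sym (only-v (there y∈xs) py)))))
  count≡1 {p} {x ∷ xs} (x∉xs ∷ unique) (there v∈xs) pv only-v
    rewrite filter-reject (T? ∘ p) {xs = xs} (λ px → All.lookup x∉xs v∈xs (only-v (here refl) px)) =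
    count≡1 unique v∈xs pv (only-v ∘ there)

module _ {A : Set} {f : A → ℕ} where

  sum-map-cong : {g : A → ℕ} (xs : List A) → (∀ x → f x ≡ g x) →
                 sum (map f xs) ≡ sum (map g xs)
  sum-map-cong xs f≗g = cong sum (map-cong f≗g xs)

  sum-map-+ : (g : A → ℕ) (xs : List A) →
              sum (map (λ x → f x + g x) xs) ≡ sum (map f xs) + sum (map g xs)
  sum-map-+ g []       = refl
  sum-map-+ g (x ∷ xs) =
    trans (cong (f x + g x +_) (sum-map-+ g xs)) (interchange (f x) (g x) _ _)

  sum-map-const : {c : ℕ} (xs : List A) → (∀ {x} → x ∈ xs → f x ≡ c) →
                  sum (map f xs) ≡ c * length xs
  sum-map-const {c} []       _       = sym (*-zeroʳ c)
  sum-map-const {c} (x ∷ xs) const-c =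
    trans (cong₂ _+_ (const-c (here refl)) (sum-map-const xs (const-c ∘ there)))
          (sym (*-suc c (length xs)))

  sum-map-partition : (p : A → Bool) (xs : List A) →
    sum (map f xs) ≡ sum (map f (filterᵇ p xs)) + sum (map f (filterᵇ (not ∘ p) xs))
  sum-map-partition p []       = refl
  sum-map-partition p (x ∷ xs) with p x
  ... | true  = trans (cong (f x +_) (sum-map-partition p xs)) (sym (+-assoc (f x) _ _))
  ... | false = trans (cong (f x +_) (sum-map-partition p xs))
                      (x∙yz≈y∙xz (f x) (sum (map f (filterᵇ p xs))) _)

  sum-map-pred : (xs : List A) → (∀ {x} → x ∈ xs → 1 ≤ f x) →
                 sum (map (λ x → f x ∸ 1) xs) + length xs ≡ sum (map f xs)
  sum-map-pred []       _     = refl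
  sum-map-pred (x ∷ xs) f-pos = begin
      (f x ∸ 1 + S) + suc (length xs)
    ≡⟨ regroup (f x ∸ 1) S (length xs) ⟩
      (f x ∸ 1 + 1) + (S + length xs)
    ≡⟨ cong₂ _+_ (m∸n+n≡m (f-pos (here refl))) (sum-map-pred xs (f-pos ∘ there)) ⟩
      f x + sum (map f xs)
    ∎
    where
    open ≡-Reasoning
    S = sum (map (λ x → f x ∸ 1) xs)
    regroup : ∀ a b c → (a + b) + suc c ≡ (a + 1) + (b + c)
    regroup = solve-∀

  sum-map-all-but-one : {xs : List A} {r : A} → Unique xs → r ∈ xs → f r ≡ 0 →
                        (∀ {y} → y ∈ xs → y ≢ r → f y ≡ 1) →
                        suc (sum (map f xs)) ≡ length xs
  sum-map-all-but-one {x ∷ xs} (x∉xs ∷ _) (here refl) fr≡0 others-1 =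
    cong suc (trans (cong (_+ sum (map f xs)) fr≡0)
                    (trans (sum-map-const xs λ y∈xs →
                                      others-1 (there y∈xs) (All.lookup x∉xs y∈xs ∘ sym))
                           (*-identityˡ _)))
  sum-map-all-but-one {x ∷ xs} (x∉xs ∷ unique) (there r∈xs) fr≡0 others-1 =
    trans (cong (λ fx → suc (fx + sum (map f xs))) (others-1 (here refl) (All.lookup x∉xs r∈xs)))
          (cong suc (sum-map-all-but-one unique r∈xs fr≡0 (others-1 ∘ there)))

  sum-map-≤-single : DecidableEquality A → {xs : List A} (v : A) → Unique xs →
                     (∀ {x} → x ∈ xs → x ≢ v → f x ≡ 0) → sum (map f xs) ≤ f v
  sum-map-≤-single _≟_ {[]}     v _                zero-off-v = z≤n
  sum-map-≤-single _≟_ {x ∷ xs} v (x∉xs ∷ unique) zero-off-v with x ≟ v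
  ... | yes refl = ≤-reflexive (trans (cong (f x +_) rest≡0) (+-identityʳ (f x)))
    where
    rest≡0 : sum (map f xs) ≡ 0
    rest≡0 = sum-map-const xs λ y∈xs → zero-off-v (there y∈xs) (All.lookup x∉xs y∈xs ∘ sym)
  ... | no x≢v = subst (_≤ f v) (sym (cong (_+ sum (map f xs)) (zero-off-v (here refl) x≢v)))
                   (sum-map-≤-single _≟_ v unique (zero-off-v ∘ there))

sum-map-count-comm : {A B : Set} (R : A → B → Bool) (xs : List A) (ys : List B) →
  sum (map (λ x → count (R x) ys) xs) ≡ sum (map (λ y → count (λ x → R x y) xs) ys)
sum-map-count-comm R []       ys = sym (sum-map-const ys (λ _ → refl))
sum-map-count-comm R (x ∷ xs) ys = begin
    count (R x) ys + sum (map (λ x → count (R x) ys) xs)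
  ≡⟨ cong₂ _+_ (count≡sum (R x) ys) (sum-map-count-comm R xs ys) ⟩
    sum (map (indicator ∘ R x) ys) + sum (map (λ y → count (λ x → R x y) xs) ys)
  ≡⟨ sum-map-+ (λ y → count (λ x → R x y) xs) ys ⟨
    sum (map (λ y → indicator (R x y) + count (λ x → R x y) xs) ys)
  ≡⟨ sum-map-cong ys (λ y → count-∷ (λ x → R x y) x xs) ⟨
    sum (map (λ y → count (λ x → R x y) (x ∷ xs)) ys)
  ∎
  where open ≡-Reasoning

module _ {A : Set} where

  Unique-⊆⇒length≤ : {xs ys : List A} → Unique xs → xs ⊆ ys → length xs ≤ length ys
  Unique-⊆⇒length≤ {[]}     _                _      = z≤n
  Unique-⊆⇒length≤ {x ∷ xs} (x∉xs ∷ unique) x∷xs⊆ys with ∈-∃++ (x∷xs⊆ys (here refl))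
  ... | us , vs , refl = subst (suc (length xs) ≤_) (sym (length-++-sucʳ us x vs))
                           (s≤s (Unique-⊆⇒length≤ unique xs⊆us++vs))
    where
    xs⊆us++vs : xs ⊆ us ++ vs
    xs⊆us++vs {z} z∈xs with ∈-++⁻ us (x∷xs⊆ys (there z∈xs))
    ... | inj₁ z∈us          = ∈-++⁺ˡ z∈us
    ... | inj₂ (here refl)   = ⊥-elim (All.lookup x∉xs z∈xs refl)
    ... | inj₂ (there z∈vs)  = ∈-++⁺ʳ us z∈vs

  ∃-∈ : (xs : List A) → 1 ≤ length xs → ∃[ x ] x ∈ xs
  ∃-∈ (x ∷ _) _ = x , here refl

  ∃-∈-≢ : DecidableEquality A → {xs : List A} → Unique xs → 2 ≤ length xs →
          (x : A) → ∃[ y ] y ∈ xs × x ≢ y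
  ∃-∈-≢ _≟_ {a ∷ []}    _               (s≤s ())
  ∃-∈-≢ _≟_ {a ∷ b ∷ _} ((a≢b ∷ _) ∷ _) _ x with x ≟ a
  ... | yes refl = b , there (here refl) , a≢b
  ... | no x≢a   = a , here refl , x≢a

module _ {d : ℕ} where

  childOf-∷⁻ : ∀ x a y → T (childOf {d} x (a ∷ y)) → y ≡ x
  childOf-∷⁻ x a y _ with y ≟w x
  ... | yes y≡x = y≡x

  childOf-∷⁺ : ∀ x (a : Fin d) → T (childOf x (a ∷ x))
  childOf-∷⁺ x a with x ≟w x
  ... | yes _   = tt
  ... | no x≢x  = x≢x refl

  childOf⇒length : ∀ (x y : Word d) → T (childOf x y) → length y ≡ suc (length x)
  childOf⇒length x (a ∷ y) c = cong (suc ∘ length) (childOf-∷⁻ x a y c)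

  childOf-asym : ∀ (x y : Word d) → T (childOf x y) → ¬ T (childOf y x)
  childOf-asym x y c c′ =
    m≢1+n+m (length y) (trans (childOf⇒length x y c) (cong suc (childOf⇒length y x c′)))

  childOf-irrefl : ∀ (x : Word d) → ¬ T (childOf x x)
  childOf-irrefl x c = 1+n≢n (sym (childOf⇒length x x c))

  adjacent⁻ : ∀ (x y : Word d) → T (adjacent x y) → T (childOf x y) ⊎ T (childOf y x)
  adjacent⁻ x y = Equivalence.to T-∨

  adjacent⁺ : ∀ (x y : Word d) → T (childOf x y) ⊎ T (childOf y x) → T (adjacent x y)
  adjacent⁺ x y = Equivalence.from T-∨

  adjacent-child : ∀ x (a : Fin d) → T (adjacent x (a ∷ x))
  adjacent-child x a = adjacent⁺ x (a ∷ x) (inj₁ (childOf-∷⁺ x a))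

  adjacent-parent : ∀ x (a : Fin d) → T (adjacent (a ∷ x) x)
  adjacent-parent x a = adjacent⁺ (a ∷ x) x (inj₂ (childOf-∷⁺ x a))

  adjacent-irrefl : ∀ (x : Word d) → ¬ T (adjacent x x)
  adjacent-irrefl x adj with adjacent⁻ x x adj
  ... | inj₁ c = childOf-irrefl x c
  ... | inj₂ c = childOf-irrefl x c

  adjacent-sym : ∀ (x y : Word d) → T (adjacent x y) → T (adjacent y x)
  adjacent-sym x y adj with adjacent⁻ x y adj
  ... | inj₁ c = adjacent⁺ y x (inj₂ c)
  ... | inj₂ c = adjacent⁺ y x (inj₁ c)

  walk-head : ∀ {S : List (Word d)} {x y} → Walk S x y → x ∈ S
  walk-head (stay x∈S)     = x∈S
  walk-head (step x∈S _ _) = x∈S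

  walk-⊆ : ∀ {S S′ : List (Word d)} {x y} → S ⊆ S′ → Walk S x y → Walk S′ x y
  walk-⊆ S⊆S′ (stay x∈S)         = stay (S⊆S′ x∈S)
  walk-⊆ S⊆S′ (step x∈S adj walk) = step (S⊆S′ x∈S) adj (walk-⊆ S⊆S′ walk)

  walk-++ : ∀ {S : List (Word d)} {x y z} → Walk S x y → Walk S y z → Walk S x z
  walk-++ (stay _)            walk′ = walk′
  walk-++ (step x∈S adj walk) walk′ = step x∈S adj (walk-++ walk walk′)

  walk-first-step : ∀ {S : List (Word d)} {x y} → Walk S x y → x ≢ y →
                    ∃[ z ] z ∈ S × T (adjacent x z)
  walk-first-step (stay _)         x≢x = ⊥-elim (x≢x refl)
  walk-first-step (step _ adj walk) _  = _ , walk-head walk , adj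

module _ {d : ℕ} (D : Domain d) where

  open import Data.List.Membership.DecPropositional (_≟w_ {d}) using (_∈?_)

  Parentless : Word d → Set
  Parentless x = ∀ {a p} → x ≡ a ∷ p → p ∉ verts D

  suffix-refl : ∀ {x : Word d} → Suffix _≡_ x x
  suffix-refl = here (≡⇒Pointwise-≡ refl)

  -- A walk in D cannot leave the extensions of a parentless r: the only way out is the step
  -- from r to its parent, which is not in D.
  suffix-step : ∀ {r u v} → Parentless r → Suffix _≡_ r u → v ∈ verts D → T (adjacent u v) →
                Suffix _≡_ r v
  suffix-step {r} {u} {v} r-parentless r⊑u v∈D adj with adjacent⁻ u v adj
  suffix-step {r} {u} {a ∷ v} r-parentless r⊑u v∈D adj | inj₁ c
    rewrite childOf-∷⁻ u a v c = there r⊑u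
  suffix-step {r} {a ∷ u} {v} r-parentless (here r≈u) v∈D adj | inj₂ c
    rewrite childOf-∷⁻ v a u c = ⊥-elim (r-parentless (Pointwise-≡⇒≡ r≈u) v∈D)
  suffix-step {r} {a ∷ u} {v} r-parentless (there r⊑u) v∈D adj | inj₂ c
    rewrite childOf-∷⁻ v a u c = r⊑u

  suffix-walk : ∀ {r u z} → Parentless r → Suffix _≡_ r u → Walk (verts D) u z → Suffix _≡_ r z
  suffix-walk r-parentless r⊑u (stay _)         = r⊑u
  suffix-walk r-parentless r⊑u (step _ adj walk) =
    suffix-walk r-parentless (suffix-step r-parentless r⊑u (walk-head walk) adj) walk

  parentless-suffix : ∀ {r y} → Parentless r → r ∈ verts D → y ∈ verts D → Suffix _≡_ r y
  parentless-suffix r-parentless r∈D y∈D = suffix-walk r-parentless suffix-refl (connected D r∈D y∈D)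

  parentless-unique : ∀ {r s} → Parentless r → Parentless s →
                      r ∈ verts D → s ∈ verts D → r ≡ s
  parentless-unique r-parentless s-parentless r∈D s∈D = Pointwise-≡⇒≡
    (Suffix.antisym (λ r≡s _ → r≡s) (parentless-suffix r-parentless r∈D s∈D)
                                    (parentless-suffix s-parentless s∈D r∈D))

  parentless-ancestor : ∀ {x} → x ∈ verts D → ∃[ r ] r ∈ verts D × Parentless r
  parentless-ancestor {[]}    []∈D = [] , []∈D , λ ()
  parentless-ancestor {a ∷ p} x∈D with p ∈? verts D
  ... | yes p∈D = parentless-ancestor p∈D
  ... | no p∉D  = a ∷ p , x∈D , λ { refl → p∉D }

  root : ∃[ r ] r ∈ verts D × Parentless r
  root = parentless-ancestor (proj₂ (∃-∈ (verts D) (nonempty D)))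

  parent-∈ : ∀ {r a p} → Parentless r → r ∈ verts D →
             a ∷ p ∈ verts D → a ∷ p ≢ r → p ∈ verts D
  parent-∈ {p = p} r-parentless r∈D x∈D x≢r with p ∈? verts D
  ... | yes p∈D = p∈D
  ... | no p∉D  = ⊥-elim (x≢r (parentless-unique (λ { refl → p∉D }) r-parentless x∈D r∈D))

  -- Counting the edges of D from both ends: every vertex other than the root has exactly one
  -- parent in D, so each side sums to |D| − 1.
  children parents : Word d → ℕ
  children x = count (childOf x) (verts D)
  parents  y = count (λ x → childOf x y) (verts D)

  deg≡children+parents : ∀ x → deg D x ≡ children x + parents x
  deg≡children+parents x = count-∨ (childOf x) (λ y → childOf y x) (verts D) (childOf-asym x)

  parents-parentless : ∀ {r} → Parentless r → parents r ≡ 0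
  parents-parentless {r} r-parentless =
    cong length (filter-none (T? ∘ λ x → childOf x r) (All.tabulate (no-parent r r-parentless)))
    where
    no-parent : ∀ r → Parentless r → ∀ {x} → x ∈ verts D → ¬ T (childOf x r)
    no-parent (a ∷ p) r-parentless {x} x∈D c =
      r-parentless refl (subst (_∈ verts D) (sym (childOf-∷⁻ x a p c)) x∈D)

  parents-other : ∀ {r y} → Parentless r → r ∈ verts D →
                  y ∈ verts D → y ≢ r → parents y ≡ 1
  parents-other {r} {[]}    r-parentless r∈D []∈D []≢r =
    ⊥-elim ([]≢r (parentless-unique (λ ()) r-parentless []∈D r∈D))
  parents-other {r} {a ∷ p} r-parentless r∈D y∈D y≢r =
    count≡1 (unique D) (parent-∈ r-parentless r∈D y∈D y≢r) (childOf-∷⁺ p a)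
            (λ {x} _ c → sym (childOf-∷⁻ x a p c))

  sum-parents : suc (sum (map parents (verts D))) ≡ size D
  sum-parents with r , r∈D , r-parentless ← root =
    sum-map-all-but-one (unique D) r∈D (parents-parentless r-parentless) (parents-other r-parentless r∈D)

  handshake : sum (map (deg D) (verts D)) + 2 ≡ 2 * size D
  handshake = begin
      sum (map (deg D) V) + 2
    ≡⟨ cong (_+ 2) (sum-map-cong V deg≡children+parents) ⟩
      sum (map (λ x → children x + parents x) V) + 2
    ≡⟨ cong (_+ 2) (sum-map-+ parents V) ⟩
      sum (map children V) + P + 2
    ≡⟨ cong (λ c → c + P + 2) (sum-map-count-comm childOf V V) ⟩
      P + P + 2
    ≡⟨ P+P+2≡2*[1+P] P ⟩
      2 * suc P
    ≡⟨ cong (2 *_) sum-parents ⟩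
      2 * size D
    ∎
    where
    open ≡-Reasoning
    V = verts D
    P = sum (map parents V)
    P+P+2≡2*[1+P] : ∀ P → P + P + 2 ≡ 2 * suc P
    P+P+2≡2*[1+P] = solve-∀

  1≤deg : 2 ≤ size D → ∀ {x} → x ∈ verts D → 1 ≤ deg D x
  1≤deg 2≤|D| {x} x∈D with y , y∈D , x≢y ← ∃-∈-≢ _≟w_ (unique D) 2≤|D| x
                     with z , z∈D , adj ← walk-first-step (connected D x∈D y∈D) x≢y =
    filter-some (T? ∘ adjacent x) (Any.map (λ { refl → adj }) z∈D)

reduced-head : ∀ {d} {a b : Fin d} {w} → Reduced (a ∷ b ∷ w) → a ≢ b
reduced-head {a = a} {b} red a≡b with a Fin.≟ b
... | no a≢b = a≢b a≡b

reduced-∷ : ∀ {d} {a b : Fin d} {w} → a ≢ b → Reduced (b ∷ w) → Reduced (a ∷ b ∷ w)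
reduced-∷ {a = a} {b} a≢b red with a Fin.≟ b
... | yes a≡b = a≢b a≡b
... | no _    = red

neighbours : ∀ {d} → Word d → List (Word d)
neighbours []                = tabulate (λ a → a ∷ [])
neighbours {suc _} (h ∷ w) = w ∷ tabulate (λ i → punchIn h i ∷ h ∷ w)

length-neighbours : ∀ {d} (x : Word d) → length (neighbours x) ≡ d
length-neighbours []                = length-tabulate _
length-neighbours {suc _} (h ∷ w) = cong suc (length-tabulate _)

adjacent⇒∈neighbours : ∀ {d} (x y : Word d) → Reduced y → T (adjacent x y) → y ∈ neighbours x
adjacent⇒∈neighbours x y red-y adj with adjacent⁻ x y adj
adjacent⇒∈neighbours [] (a ∷ y) red-y adj | inj₁ c rewrite childOf-∷⁻ [] a y c = ∈-tabulate⁺ a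
adjacent⇒∈neighbours {suc _} (h ∷ w) (a ∷ y) red-y adj | inj₁ c
  rewrite childOf-∷⁻ (h ∷ w) a y c =
  there (subst (λ b → b ∷ h ∷ w ∈ _) (punchIn-punchOut h≢a) (∈-tabulate⁺ (punchOut h≢a)))
  where
  h≢a : h ≢ a
  h≢a = reduced-head {w = w} red-y ∘ sym
adjacent⇒∈neighbours {suc _} (h ∷ w) y red-y adj | inj₂ c = here (sym (childOf-∷⁻ y h w c))

deg≤ : ∀ {d} (D : Domain d) x → deg D x ≤ d
deg≤ D x = subst (deg D x ≤_) (length-neighbours x)
  (Unique-⊆⇒length≤ (Unique.filter⁺ (T? ∘ adjacent x) (unique D)) λ y∈ →
    let y∈D , adj = ∈-filter⁻ (T? ∘ adjacent x) {xs = verts D} y∈ in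
    adjacent⇒∈neighbours x _ (All.lookup (reducedV D) y∈D) adj)

module _ {m : ℕ} (D : Domain (suc m)) (2≤|D| : 2 ≤ size D) where

  boundary-identity : 2 + suc m * size D + τ D ≡ 2 * size D + m * bsize D
  boundary-identity = begin
      2 + suc m * size D + τ D
    ≡⟨ cong (λ k → 2 + suc m * k + τ D) (count+count-not≡length isBoundary V) ⟨
      2 + suc m * (b + i) + τ D
    ≡⟨ regroup m b i (τ D) ⟩
      m * b + ((τ D + b) + suc m * i + 2)
    ≡⟨ cong₂ (λ s t → m * b + (s + t + 2)) τ+b≡Σ∂ (sym Σint≡d*i) ⟩
      m * b + (sum (map (deg D) (boundary D)) + sum (map (deg D) interior) + 2)
    ≡⟨ cong (λ s → m * b + (s + 2)) (sum-map-partition isBoundary V) ⟨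
      m * b + (sum (map (deg D) V) + 2)
    ≡⟨ cong (m * b +_) (handshake D) ⟩
      m * b + 2 * size D
    ≡⟨ +-comm (m * b) _ ⟩
      2 * size D + m * b
    ∎
    where
    open ≡-Reasoning
    V = verts D
    isBoundary : Word (suc m) → Bool
    isBoundary x = deg D x <ᵇ suc m
    interior = filterᵇ (not ∘ isBoundary) V
    b = bsize D
    i = length interior

    τ+b≡Σ∂ : τ D + b ≡ sum (map (deg D) (boundary D))
    τ+b≡Σ∂ = sum-map-pred (boundary D) λ x∈∂D →
      1≤deg D 2≤|D| (proj₁ (∈-filter⁻ (T? ∘ isBoundary) {xs = V} x∈∂D))

    Σint≡d*i : sum (map (deg D) interior) ≡ suc m * i
    Σint≡d*i = sum-map-const interior λ {x} x∈int →
      let not-boundary = proj₂ (∈-filter⁻ (T? ∘ (not ∘ isBoundary)) {xs = V} x∈int) in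
      ≤-antisym (deg≤ D x) (≮⇒≥ λ deg<d →
        subst T (Equivalence.to T-not-≡ not-boundary) (<⇒<ᵇ deg<d))

    regroup : ∀ m b i t → 2 + suc m * (b + i) + t ≡ m * b + ((t + b) + suc m * i + 2)
    regroup = solve-∀

module _ {m : ℕ} (D E : Domain (suc m)) (|D|≡|E| : size D ≡ size E) (2≤|D| : 2 ≤ size D) where

  private
    A = 2 + suc m * size D

    identity-D : A + τ D ≡ 2 * size D + m * bsize D
    identity-D = boundary-identity D 2≤|D|

    identity-E : A + τ E ≡ 2 * size D + m * bsize E
    identity-E = subst (λ k → 2 + suc m * k + τ E ≡ 2 * k + m * bsize E) (sym |D|≡|E|)
                       (boundary-identity E (subst (2 ≤_) |D|≡|E| 2≤|D|))

  bsize≤⇒τ≤ : bsize D ≤ bsize E → τ D ≤ τ E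
  bsize≤⇒τ≤ ∂D≤∂E = +-cancelˡ-≤ A (τ D) (τ E)
    (subst₂ _≤_ (sym identity-D) (sym identity-E)
      (+-monoʳ-≤ (2 * size D) (*-monoʳ-≤ m ∂D≤∂E)))

  τ<⇒bsize≤ : τ D < m → bsize D ≤ bsize E
  τ<⇒bsize≤ τD<m = ≮⇒≥ λ ∂E<∂D → <⇒≱ (+-monoʳ-< A τD<m) (begin
      A + m                          ≤⟨ +-monoˡ-≤ m (m≤m+n A (τ E)) ⟩
      A + τ E + m                    ≡⟨ cong (_+ m) identity-E ⟩
      2 * size D + m * bsize E + m   ≡⟨ +-assoc (2 * size D) _ m ⟩
      2 * size D + (m * bsize E + m) ≡⟨ cong (2 * size D +_) (+-comm _ m) ⟩
      2 * size D + (m + m * bsize E) ≡⟨ cong (2 * size D +_) (*-suc m (bsize E)) ⟨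
      2 * size D + m * suc (bsize E) ≤⟨ +-monoʳ-≤ (2 * size D) (*-monoʳ-≤ m ∂E<∂D) ⟩
      2 * size D + m * bsize D       ≡⟨ identity-D ⟨
      A + τ D                        ∎)
    where open ≤-Reasoning

module AddLeaf {d : ℕ} (E : Domain d) {v : Word d} {a : Fin d}
         (v∈E : v ∈ verts E) (reduced-av : Reduced (a ∷ v)) (av∉E : a ∷ v ∉ verts E) where

  addLeaf : Domain d
  addLeaf = record
    { verts     = (a ∷ v) ∷ verts E
    ; reducedV  = reduced-av ∷ reducedV E
    ; unique    = ¬Any⇒All¬ (verts E) av∉E ∷ unique E
    ; nonempty  = s≤s z≤n
    ; connected = connected′
    }
    where
    connected′ : ∀ {x y} → x ∈ (a ∷ v) ∷ verts E → y ∈ (a ∷ v) ∷ verts E →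
                 Walk ((a ∷ v) ∷ verts E) x y
    connected′ (here refl) (here refl) = stay (here refl)
    connected′ (here refl) (there y∈E) =
      step (here refl) (adjacent-parent v a) (walk-⊆ there (connected E v∈E y∈E))
    connected′ (there x∈E) (here refl) =
      walk-++ (walk-⊆ there (connected E x∈E v∈E)) (step (there v∈E) (adjacent-child v a) (stay (here refl)))
    connected′ (there x∈E) (there y∈E) = walk-⊆ there (connected E x∈E y∈E)

  grandchild-∉ : ∀ b → b ∷ a ∷ v ∉ verts E
  grandchild-∉ b bav∈E with r , r∈E , r-parentless ← root E =
    av∉E (parent-∈ E r-parentless r∈E bav∈E bav≢r)
    where
    bav≢r : b ∷ a ∷ v ≢ r
    bav≢r refl = <⇒≱ (m<n+m (length v) {2} (s≤s z≤n))
                     (Suffix.length-mono (parentless-suffix E r-parentless r∈E v∈E))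

  adjacent-leaf⇒parent : ∀ {y} → y ∈ verts E → T (adjacent y (a ∷ v)) → y ≡ v
  adjacent-leaf⇒parent {y} y∈E adj with adjacent⁻ y (a ∷ v) adj
  ... | inj₁ c = sym (childOf-∷⁻ y a v c)
  adjacent-leaf⇒parent {b ∷ y} y∈E adj | inj₂ c rewrite childOf-∷⁻ (a ∷ v) b y c =
    ⊥-elim (grandchild-∉ b y∈E)

  deg-addLeaf-≢ : ∀ {y} → y ∈ verts E → y ≢ v → deg addLeaf y ≡ deg E y
  deg-addLeaf-≢ {y} y∈E y≢v =
    cong length (filter-reject (T? ∘ adjacent y) (y≢v ∘ adjacent-leaf⇒parent y∈E))

  deg-addLeaf-parent : deg addLeaf v ≡ suc (deg E v)
  deg-addLeaf-parent =
    cong length (filter-accept (T? ∘ adjacent v) (adjacent-child v a))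

  deg-addLeaf-leaf : deg addLeaf (a ∷ v) ≡ 1
  deg-addLeaf-leaf = trans
    (cong length (filter-reject (T? ∘ adjacent (a ∷ v)) (adjacent-irrefl (a ∷ v))))
    (count≡1 (unique E) v∈E (adjacent-parent v a)
             (λ {y} y∈E adj → adjacent-leaf⇒parent y∈E (adjacent-sym (a ∷ v) y adj)))

module _ {n : ℕ} where

  private
    d = suc (suc n)

  FreeSlot : Domain d → Word d → Fin d → Set
  FreeSlot E v a = Reduced (a ∷ v) × a ∷ v ∉ verts E

  LeafOrFull : Domain d → Word d → Set
  LeafOrFull E y = deg E y ≡ 1 ⊎ deg E y ≡ d

  -- Leaves are attached to the tip through its free slots; the last free slot becomes the new
  -- tip, which leaves the old one full. So every vertex but the tip is a leaf or full, and
  -- τ ≤ deg(tip) − 1 ≤ d − 2.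
  record Caterpillar (k : ℕ) : Set where
    constructor caterpillar
    field
      domain        : Domain d
      size≡         : size domain ≡ k
      tip           : Word d
      tip∈          : tip ∈ verts domain
      free          : List (Fin d)
      free-unique   : Unique free
      free-slots    : All (FreeSlot domain tip) free
      free-nonempty : 1 ≤ length free
      free+deg≡d    : length free + deg domain tip ≡ d
      leaf-or-full  : ∀ {y} → y ∈ verts domain → y ≢ tip → LeafOrFull domain y

  singleton : Domain d
  singleton = record
    { verts     = [] ∷ []
    ; reducedV  = tt ∷ []
    ; unique    = [] ∷ []
    ; nonempty  = s≤s z≤n
    ; connected = λ { (here refl) (here refl) → stay (here refl) }
    }

  caterpillar₁ : Caterpillar 1
  caterpillar₁ = caterpillar singleton refl [] (here refl) (allFin d) (allFin⁺ d)
    (tabulate⁺ {f = id} λ a → tt , λ { (here ()) ; (there ()) })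
    (s≤s z≤n)
    (trans (+-identityʳ _) (length-tabulate {n = d} id))
    λ { (here refl) []≢[] → ⊥-elim ([]≢[] refl) }

  grow : ∀ {k} → Caterpillar k → Caterpillar (suc k)
  grow (caterpillar E |E|≡k v v∈E (a ∷ []) _ ((red-av , av∉E) ∷ []) _ 1+deg≡d leaf-or-full) =
    caterpillar addLeaf (cong suc |E|≡k) (a ∷ v) (here refl) (tabulate (punchIn a))
      (Unique.tabulate⁺ (punchIn-injective a _ _)) (tabulate⁺ slot) (s≤s z≤n)
      free+deg≡d leaf-or-full′
    where
    open AddLeaf E v∈E red-av av∉E

    slot : ∀ i → FreeSlot addLeaf (a ∷ v) (punchIn a i)
    slot i = reduced-∷ {w = v} (punchInᵢ≢i a i) red-av , λ
      { (here eq)    → 1+n≢n (cong length eq)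
      ; (there b∈E) → grandchild-∉ (punchIn a i) b∈E
      }

    free+deg≡d : length (tabulate (punchIn a)) + deg addLeaf (a ∷ v) ≡ d
    free+deg≡d = trans (cong₂ _+_ (length-tabulate (punchIn a)) deg-addLeaf-leaf) (+-comm (suc n) 1)

    leaf-or-full′ : ∀ {y} → y ∈ verts addLeaf → y ≢ a ∷ v → LeafOrFull addLeaf y
    leaf-or-full′ (here refl) y≢av = ⊥-elim (y≢av refl)
    leaf-or-full′ {y} (there y∈E) _ with y ≟w v
    ... | yes refl = inj₂ (trans deg-addLeaf-parent 1+deg≡d)
    ... | no y≢v   =
      subst (λ k → k ≡ 1 ⊎ k ≡ d) (sym (deg-addLeaf-≢ y∈E y≢v)) (leaf-or-full y∈E y≢v)
  grow (caterpillar E |E|≡k v v∈E (a ∷ b ∷ free) (a∉free ∷ unique) ((red-av , av∉E) ∷ slots) _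
                    free+deg≡d leaf-or-full) =
    caterpillar addLeaf (cong suc |E|≡k) v (there v∈E) (b ∷ free) unique slots′ (s≤s z≤n)
      free+deg≡d′ leaf-or-full′
    where
    open AddLeaf E v∈E red-av av∉E

    slots′ : All (FreeSlot addLeaf v) (b ∷ free)
    slots′ = All.zipWith (λ (a≢c , red-cv , cv∉E) → red-cv , λ
      { (here eq)    → a≢c (sym (∷-injectiveˡ eq))
      ; (there cv∈E) → cv∉E cv∈E
      }) (a∉free , slots)

    free+deg≡d′ : length (b ∷ free) + deg addLeaf v ≡ d
    free+deg≡d′ = begin
      length (b ∷ free) + deg addLeaf v      ≡⟨ cong (length (b ∷ free) +_) deg-addLeaf-parent ⟩
      length (b ∷ free) + suc (deg E v)      ≡⟨ +-suc (length (b ∷ free)) (deg E v) ⟩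
      length (a ∷ b ∷ free) + deg E v        ≡⟨ free+deg≡d ⟩
      d                                      ∎
      where open ≡-Reasoning

    leaf-or-full′ : ∀ {y} → y ∈ verts addLeaf → y ≢ v → LeafOrFull addLeaf y
    leaf-or-full′ (here refl)  _   = inj₁ deg-addLeaf-leaf
    leaf-or-full′ (there y∈E) y≢v =
      subst (λ k → k ≡ 1 ⊎ k ≡ d) (sym (deg-addLeaf-≢ y∈E y≢v)) (leaf-or-full y∈E y≢v)

  caterpillar-of-size : ∀ k → Caterpillar (suc k)
  caterpillar-of-size zero    = caterpillar₁
  caterpillar-of-size (suc k) = grow (caterpillar-of-size k)

  τ-caterpillar : ∀ {k} (C : Caterpillar k) → τ (Caterpillar.domain C) ≤ n
  τ-caterpillar C = ≤-trans
    (sum-map-≤-single _≟w_ tip (Unique.filter⁺ (T? ∘ isBoundary) (unique domain)) off-tip)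
    (∸-monoˡ-≤ 1 deg-tip≤1+n)
    where
    open Caterpillar C
    isBoundary : Word d → Bool
    isBoundary x = deg domain x <ᵇ d

    off-tip : ∀ {x} → x ∈ boundary domain → x ≢ tip → deg domain x ∸ 1 ≡ 0
    off-tip x∈∂ x≢tip with ∈-filter⁻ (T? ∘ isBoundary) {xs = verts domain} x∈∂
    ... | x∈E , deg<d with leaf-or-full x∈E x≢tip
    ... | inj₁ deg≡1 = cong (_∸ 1) deg≡1
    ... | inj₂ deg≡d = ⊥-elim (<-irrefl deg≡d (<ᵇ⇒< _ _ deg<d))

    deg-tip≤1+n : deg domain tip ≤ suc n
    deg-tip≤1+n = ≤-pred (subst (suc (deg domain tip) ≤_) free+deg≡d
                                (+-monoˡ-≤ (deg domain tip) free-nonempty))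

∃-domain-τ≤ : ∀ n {k} → 1 ≤ k → ∃[ E ] size {suc (suc n)} E ≡ k × τ E ≤ n
∃-domain-τ≤ n {suc k} _ = domain , size≡ , τ-caterpillar C
  where
  C = caterpillar-of-size k
  open Caterpillar C

theorem4p3 : (d : ℕ) → 2 ≤ d → (D : Domain d) → 2 ≤ size D →
    (IsIsoperimetricProfile d (size D) (bsize D) ⇔ τ D ≤ d ∸ 2)
theorem4p3 (suc zero) (s≤s ()) _ _
theorem4p3 (suc (suc n)) _ D 2≤|D| = mk⇔ optimal⇒τ≤n τ≤n⇒optimal
  where
  optimal⇒τ≤n : IsIsoperimetricProfile (suc (suc n)) (size D) (bsize D) → τ D ≤ n
  optimal⇒τ≤n (_ , minimal)
    with E , |E|≡|D| , τE≤n ← ∃-domain-τ≤ n (≤-trans (n≤1+n 1) 2≤|D|) =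
    ≤-trans (bsize≤⇒τ≤ D E (sym |E|≡|D|) 2≤|D| (minimal E |E|≡|D|)) τE≤n

  τ≤n⇒optimal : τ D ≤ n → IsIsoperimetricProfile (suc (suc n)) (size D) (bsize D)
  τ≤n⇒optimal τD≤n =
    (D , refl , refl) , λ E |E|≡|D| → τ<⇒bsize≤ D E (sym |E|≡|D|) 2≤|D| (s≤s τD≤n)
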